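{- Let $W$ be a $d$-dimensional world with $d \ge 2$, let $a_3,\dots,a_d$ be positive integers, and let $B$ be the biray $B = \{ l_W^{ -1}(m,n,a_3,\dots,a_d) : m,n \ge 0,\ (m,n)\neq(0,0)\}$. Then the completion sequence of $B$ is additively periodic; equivalently, there exist constants $N_B \ge 0$ and $\pi_B \ge 1$ such that for all integers $m,n > N_B$, the position $l_W^{ -1}(m,n,a_3,\dots,a_d)$ is a $\mathcal{P}$-position if and only if $l_W^{ -1}(m+\pi_B,n+\pi_B,a_3,\dots,a_d)$ is a $\mathcal{P}$-position.
   Context: Tree nim: a position is a finite tree, possibly empty, whose vertices carry positive integer sizes; a leaf is a vertex of degree at most $1$; a move chooses a leaf and decreases its size by a positive integer, deleting the vertex if its size becomes $0$; normal play (the player unable to move loses). A position is $\mathcal{P}$ iff no move leads to a $\mathcal{P}$-position. World: fix a finite tree $T$ with $d$ leaves ordered $l_1,\dots,l_d$ and fix positive sizes for its non-leaf vertices. The world $W$ consists of the positions with underlying tree $T$, these non-leaf sizes and arbitrary positive leaf sizes, together with all positions reachable from these in one move. The lattice map $l_W$ sends a position of $W$ to the tuple of sizes of $l_1,\dots,l_d$ (with $0$ for a deleted leaf); it is a bijection from $W$ onto $\{(n_1,\dots,n_d)\in\mathbb{N}_0^d : n_i=0 \text{ for at most one } i\}$; $d$ is the dimension. For the biray $B$, $B_b$ denotes the ray $(r_m)_{m\ge0}$ with $l_W(r_m)=(m,b,a_3,\dots,a_d)$; each such ray contains exactly one $\mathcal{P}$-position $r_m$, and $\mathcal{P}(B_b)$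 denotes that $m$. The completion sequence of $B$ is $(\mathcal{P}(B_n))_{n\ge1}$. -}

module Defs where

open import Data.Nat using (ℕ; zero; suc; _+_; _≤_; _<_; _<ᵇ_)
open import Data.Bool using (Bool; true; false; _∧_; _∨_; if_then_else_)
open import Data.Fin using (Fin; zero; suc; toℕ; _≟_)
open import Data.Maybe using (Maybe; just; nothing)
import Data.Maybe as Maybe
open import Data.List using (List; map; allFin)
open import Data.Nat.ListAction using (sum)
open import Data.Product using (Σ; _×_; ∃; ∃-syntax)
open import Relation.Nullary using (¬_; yes; no)
open import Relation.Nullary.Decidable using (⌊_⌋)
open import Relation.Binary.PropositionalEquality using (_≡_; _≢_)
open import Function using (_∘_)

-- A (nonempty) finite tree on the vertex set Fin (suc n) is encoded by a
-- parent function: vertex (suc i) is joined to the vertex (par i), whose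
-- index is at most toℕ i, i.e. strictly smaller than that of (suc i).
-- Every finite nonempty tree is isomorphic to one of this form.

record Tree : Set where
  field
    size   : ℕ                             -- the tree has suc size vertices
    par    : Fin size → Fin (suc size)
    par-lt : ∀ i → toℕ (par i) ≤ toℕ i

module _ (T : Tree) where
  open Tree T

  Vertex : Set
  Vertex = Fin (suc size)

  parentOf : Vertex → Maybe Vertex
  parentOf zero    = nothing
  parentOf (suc i) = just (par i)

  isParentOf : Vertex → Vertex → Bool
  isParentOf p w with parentOf w
  ... | just q  = ⌊ q ≟ p ⌋
  ... | nothing = false

  adj : Vertex → Vertex → Bool
  adj u v = isParentOf u v ∨ isParentOf v u

  -- A position on T: a size for every vertex; size 0 means the vertex
  -- has been deleted. (All positions reachable from a position of a world
  -- keep the alive vertices forming a subtree of T.)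
  Position : Set
  Position = Vertex → ℕ

  deg : Position → Vertex → ℕ
  deg s v = sum (map (λ u → if adj u v ∧ (0 <ᵇ s u) then 1 else 0) (allFin (suc size)))

  IsLeaf : Position → Vertex → Set
  IsLeaf s v = 0 < s v × deg s v ≤ 1

  Move : Position → Position → Set
  Move s s' = Σ Vertex λ v → IsLeaf s v × s' v < s v × (∀ u → u ≢ v → s' u ≡ s u)

  -- P- and N-positions, defined by the usual recursion
  -- (P iff no move leads to a P-position); the game is well-founded
  -- since the total size strictly decreases.
  data IsP (s : Position) : Set
  data IsN (s : Position) : Set

  data IsP s where
    allToN : (∀ s' → Move s s' → IsN s') → IsP s

  data IsN s where
    toP : ∀ s' → Move s s' → IsP s' → IsN s

  IsLeafT : Vertex → Set
  IsLeafT v = deg (λ _ → 1) v ≤ 1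

record World (d : ℕ) : Set where
  field
    tree       : Tree
    leaf       : Fin d → Vertex tree
    leaf-inj   : ∀ i j → leaf i ≡ leaf j → i ≡ j
    leaf-leaf  : ∀ i → IsLeafT tree (leaf i)
    leaf-all   : ∀ v → IsLeafT tree v → ∃[ i ] leaf i ≡ v
    inner      : Vertex tree → ℕ
    inner-pos  : ∀ v → ¬ IsLeafT tree v → 0 < inner v

findIndex : ∀ {d k} → (Fin d → Fin k) → Fin k → Maybe (Fin d)
findIndex {zero}  f v = nothing
findIndex {suc d} f v with f zero ≟ v
... | yes _ = just zero
... | no  _ = Maybe.map suc (findIndex (f ∘ suc) v)

lW⁻¹ : ∀ {d} (W : World d) → (Fin d → ℕ) → Position (World.tree W)
lW⁻¹ W t v with findIndex (World.leaf W) v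
... | just i  = t i
... | nothing = World.inner W v

-- the tuple (m, n, a₃, …, a_d), with d = e + 2 and a : Fin e → ℕ
tuple : ∀ {e} → ℕ → ℕ → (Fin e → ℕ) → Fin (suc (suc e)) → ℕ
tuple m n a zero          = m
tuple m n a (suc zero)    = n
tuple m n a (suc (suc i)) = a i

-- Fix two leaves l₁, l₂ of T and sizes s on the other vertices, and let P(m, n) say that s
-- with sizes m, n on l₁, l₂ is a P-position. By induction on the sizes off l₁, l₂, P lies in a
-- band |m − n| ≤ K and is eventually periodic along the diagonal. For the band, if (m, n) is
-- P then every (i, n) with i < m moves to a P-position, either in its column below n or, by a
-- move elsewhere, inside the band of that option; these witnesses are distinct columns, so
-- m ≤ n + 2K′ + 2. For periodicity, once m, n are large, P(m, n) holds iff no P-position lies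
-- to its left or below it and no option off l₁, l₂ is P at (m, n), and the last condition is
-- periodic by induction. By pigeonhole two diagonal windows of size 2K, at bases differing by
-- a multiple of that period, coincide, and the recurrence carries the agreement to the whole
-- quadrant: off the band both sides are false, and inside it every position the recurrence
-- consults stays above the base.

module Submission where

open import Defs
open import Data.Bool using (true; false; _∧_; if_then_else_)
open import Data.Empty using (⊥; ⊥-elim)
open import Data.Fin using (Fin; zero; suc; toℕ; fromℕ<; combine) renaming (_≟_ to _≟ᶠ_)
open import Data.Fin.Properties
  using (any?; pigeonhole; injective⇒≤; toℕ-injective; toℕ-fromℕ<; toℕ<n; combine-injective)
import Data.Fin.Properties as Fin
open import Data.List using ([]; _∷_; map; allFin)
open import Data.List.Properties using (map-cong)
open import Data.Maybe using (just; nothing)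
open import Data.Nat
open import Data.Nat.Divisibility using (_∣_; divides; ∣-trans; m∣m*n; m≤n⇒m!∣n!)
open import Data.Nat.Induction using (<-wellFounded)
open import Data.Nat.ListAction using (sum)
open import Data.Nat.Properties
open import Algebra.Properties.CommutativeSemigroup +-commutativeSemigroup using (xy∙z≈xz∙y)
open import Data.Nat.Tactic.RingSolver using (solve-∀)
open import Data.Product using (Σ; ∃; ∃₂; _×_; _,_; proj₁; proj₂; map₂; swap)
open import Data.Sum using (_⊎_; inj₁; inj₂; [_,_]′)
open import Data.Vec.Functional using (updateAt)
open import Data.Vec.Functional.Properties using (updateAt-updates; updateAt-minimal)
open import Function using (_∘_; id; const; flip; case_of_)
open import Function.Bundles using (_⇔_; mk⇔; Equivalence)
open import Function.Properties.Equivalence using ()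
  renaming (refl to ⇔-refl; sym to ⇔-sym; trans to ⇔-trans)
open import Induction.WellFounded using (Acc; acc)
open import Relation.Binary using (tri<; tri≈; tri>)
open import Relation.Binary.PropositionalEquality
open import Relation.Nullary using (¬_; Dec; yes; no)
open import Relation.Nullary.Decidable using (_×-dec_; ¬?)

open Equivalence using (to; from)

UpwardClosed : (ℕ → Set) → Set
UpwardClosed P = ∀ {c c′} → c ≤ c′ → P c → P c′

common-bound : ∀ {n} {P : Fin n → ℕ → Set} → (∀ i → UpwardClosed (P i)) →
               (∀ i → ∃ (P i)) → ∃ λ c → ∀ i → P i c
common-bound {zero}  up ex = 0 , λ ()
common-bound {suc n} up ex with ex zero | common-bound (up ∘ suc) (ex ∘ suc)
... | c , p₀ | d , pₛ = c ⊔ d , λ where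
  zero    → up zero (m≤m⊔n c d) p₀
  (suc i) → up (suc i) (m≤n⊔m c d) (pₛ i)

common-bound< : ∀ {P : ℕ → ℕ → Set} → (∀ i → UpwardClosed (P i)) →
                ∀ n → (∀ i → i < n → ∃ (P i)) → ∃ λ c → ∀ i → i < n → P i c
common-bound< up zero    ex = 0 , λ _ ()
common-bound< up (suc n) ex with ex n (n<1+n n) | common-bound< up n (λ i → ex i ∘ m<n⇒m<1+n)
... | c , pₙ | d , p< = c ⊔ d , λ i i<1+n → case m<1+n⇒m<n∨m≡n i<1+n of λ where
  (inj₁ i<n)  → up i (m≤n⊔m c d) (p< i i<n)
  (inj₂ refl) → up i (m≤m⊔n c d) pₙ

∃-under-Dec : ∀ {A : Set} {P : ℕ → Set} → Dec A → (A → ∃ P) → ∃ λ c → A → P c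
∃-under-Dec (yes a) ex = map₂ const (ex a)
∃-under-Dec (no ¬a) _  = 0 , ⊥-elim ∘ ¬a

sum-map-mono : ∀ {A : Set} {f g : A → ℕ} → (∀ x → f x ≤ g x) →
               ∀ xs → sum (map f xs) ≤ sum (map g xs)
sum-map-mono f≤g []       = z≤n
sum-map-mono f≤g (x ∷ xs) = +-mono-≤ (f≤g x) (sum-map-mono f≤g xs)

total : ∀ {n} → (Fin n → ℕ) → ℕ
total {zero}  f = 0
total {suc n} f = f zero + total (f ∘ suc)

total-cong : ∀ {n} {f g : Fin n → ℕ} → f ≗ g → total f ≡ total g
total-cong {zero}  f≗g = refl
total-cong {suc n} f≗g = cong₂ _+_ (f≗g zero) (total-cong (f≗g ∘ suc))

total-updateAt-< : ∀ {n} (f : Fin n → ℕ) v {k} → k < f v → total (updateAt f v (const k)) < total f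
total-updateAt-< f zero    k<fv = +-monoˡ-< (total (f ∘ suc)) k<fv
total-updateAt-< f (suc v) k<fv = +-monoʳ-< (f zero) (total-updateAt-< (f ∘ suc) v k<fv)

at-most-one : ∀ {Q : ℕ → Set} → (∀ {x y} → x < y → Q y → ¬ Q x) →
              ∀ {x y} → Q x → Q y → x ≡ y
at-most-one excl {x} {y} qx qy with <-cmp x y
... | tri< x<y _ _ = ⊥-elim (excl x<y qy qx)
... | tri≈ _ x≡y _ = x≡y
... | tri> _ _ y<x = ⊥-elim (excl y<x qx qy)

injection⇒≤ : ∀ {a b} (f : ∀ i → i < a → ℕ) → (∀ i i<a → f i i<a < b) →
              (∀ {i j} i<a j<a → f i i<a ≡ f j j<a → i ≡ j) → a ≤ b
injection⇒≤ {a} {b} f f<b f-inj = injective⇒≤ {f = code} code-injective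
  where
  code : Fin a → Fin b
  code x = fromℕ< (f<b (toℕ x) (toℕ<n x))
  code-injective : ∀ {x y} → code x ≡ code y → x ≡ y
  code-injective {x} {y} eq = toℕ-injective (f-inj _ _ (begin
    f (toℕ x) _           ≡⟨ toℕ-fromℕ< _ ⟨
    toℕ (code x)          ≡⟨ cong toℕ eq ⟩
    toℕ (code y)          ≡⟨ toℕ-fromℕ< _ ⟩
    f (toℕ y) _           ∎))
    where open ≡-Reasoning

∣n! : ∀ {m n} → 1 ≤ m → m ≤ n → m ∣ n !
∣n! {suc m} _ m≤n = ∣-trans (m∣m*n (m !)) (m≤n⇒m!∣n! m≤n)

encode : ∀ {m} n → (Fin n → Fin m) → Fin (m ^ n)
encode zero    f = zero
encode (suc n) f = combine (f zero) (encode n (f ∘ suc))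

encode-injective : ∀ {m} n {f g : Fin n → Fin m} → encode n f ≡ encode n g → f ≗ g
encode-injective (suc n) {f} {g} eq zero    = proj₁ (combine-injective (f zero) _ (g zero) _ eq)
encode-injective (suc n) {f} {g} eq (suc i) =
  encode-injective n (proj₂ (combine-injective (f zero) _ (g zero) _ eq)) i

repetition : ∀ {m n} (w : ℕ → Fin n → Fin m) → ∃₂ λ t t′ → t < t′ × w t ≗ w t′
repetition {m} {n} w with pigeonhole (n<1+n (m ^ n)) (λ x → encode n (w (toℕ x)))
... | x , y , x<y , eq = toℕ x , toℕ y , x<y , encode-injective n eq

bit : ∀ {A : Set} → Dec A → Fin 2
bit (yes _) = zero
bit (no _)  = suc zero

bit-≡⇒⇔ : ∀ {A B : Set} (a? : Dec A) (b? : Dec B) → bit a? ≡ bit b? → A ⇔ B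
bit-≡⇒⇔ (yes a) (yes b) _ = mk⇔ (const b) (const a)
bit-≡⇒⇔ (no ¬a) (no ¬b) _ = mk⇔ (⊥-elim ∘ ¬a) (⊥-elim ∘ ¬b)

-- Eventually periodic recurrences on ℕ²

PeriodicBeyond : (ℕ → ℕ → Set) → ℕ → ℕ → Set
PeriodicBeyond Q N p = ∀ m n → N < m → N < n → Q m n ⇔ Q (m + p) (n + p)

EventuallyPeriodic : (ℕ → ℕ → Set) → Set
EventuallyPeriodic Q = Σ ℕ λ N → Σ ℕ λ p → 1 ≤ p × PeriodicBeyond Q N p

module _ {Q : ℕ → ℕ → Set} where

  PeriodicBeyond-mono : ∀ {N N′ p} → N ≤ N′ → PeriodicBeyond Q N p → PeriodicBeyond Q N′ p
  PeriodicBeyond-mono N≤N′ per m n N′<m N′<n =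
    per m n (≤-<-trans N≤N′ N′<m) (≤-<-trans N≤N′ N′<n)

  PeriodicBeyond-* : ∀ {N p} → PeriodicBeyond Q N p → ∀ t → PeriodicBeyond Q N (t * p)
  PeriodicBeyond-* per zero m n _ _ rewrite +-identityʳ m | +-identityʳ n = ⇔-refl
  PeriodicBeyond-* {p = p} per (suc t) m n N<m N<n =
    ⇔-trans (per m n N<m N<n)
      (subst₂ (λ x y → Q (m + p) (n + p) ⇔ Q x y) (+-assoc m p (t * p)) (+-assoc n p (t * p))
        (PeriodicBeyond-* per t (m + p) (n + p)
          (<-≤-trans N<m (m≤m+n m p)) (<-≤-trans N<n (m≤m+n n p))))

  PeriodicBeyond-∣ : ∀ {N p q} → PeriodicBeyond Q N p → p ∣ q → PeriodicBeyond Q N q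
  PeriodicBeyond-∣ per (divides t refl) = PeriodicBeyond-* per t

  PeriodicBeyond-! : ∀ {N p c} → PeriodicBeyond Q N p → 1 ≤ p → N ≤ c → p ≤ c →
                     PeriodicBeyond Q c (c !)
  PeriodicBeyond-! per 1≤p N≤c p≤c = PeriodicBeyond-mono N≤c (PeriodicBeyond-∣ per (∣n! 1≤p p≤c))

  PeriodicBeyond-cong : ∀ {Q′ N p} → (∀ m n → Q m n ⇔ Q′ m n) →
                        PeriodicBeyond Q N p → PeriodicBeyond Q′ N p
  PeriodicBeyond-cong {p = p} Q⇔Q′ per m n N<m N<n =
    ⇔-trans (⇔-sym (Q⇔Q′ m n)) (⇔-trans (per m n N<m N<n) (Q⇔Q′ (m + p) (n + p)))

  EventuallyPeriodic-cong : ∀ {Q′} → (∀ m n → Q m n ⇔ Q′ m n) →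
                            EventuallyPeriodic Q → EventuallyPeriodic Q′
  EventuallyPeriodic-cong Q⇔Q′ (N , p , 1≤p , per) = N , p , 1≤p , PeriodicBeyond-cong Q⇔Q′ per

FirstInRow : (ℕ → ℕ → Set) → ℕ → ℕ → Set
FirstInRow Q m n = ∀ {k} → k < m → ¬ Q k n

FirstInColumn : (ℕ → ℕ → Set) → ℕ → ℕ → Set
FirstInColumn Q m n = FirstInRow (flip Q) n m

module _ (Q R : ℕ → ℕ → Set) (K : ℕ)
         (Q-unique : ∀ {m m′ n} → Q m n → Q m′ n → m ≡ m′)
         (R-band : ∀ {m n} → R m n → m ≤ n + K × n ≤ m + K)
         (¬Q⇒ : ∀ {m n} → ¬ Q m n →
                (∃ λ k → k < m × Q k n) ⊎ (∃ λ k → k < n × Q m k) ⊎ R m n)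
  where

  -- If Q m n, each (i, n) with 0 < i < m fails Q, and ¬Q⇒ turns this into a column below
  -- n + 2K + 1; these columns are distinct, which bounds m.
  row-bound : ∀ {m n} → Q m n → m ≤ n + (2 + K + K)
  row-bound {zero}      _ = z≤n
  row-bound {suc m} {n} q = subst (suc m ≤_) (sym (+-suc n _)) (s≤s m≤)
    where
    Witness : ℕ → ℕ → Set
    Witness i c = (c < n × Q (suc i) c) ⊎ (n ≤ c × c ≡ suc i + K)

    witness : ∀ i → i < m → ∃ λ c → c < n + suc (K + K) × Witness i c
    witness i i<m with ¬Q⇒ (λ qᵢ → <-irrefl (suc-injective (Q-unique qᵢ q)) i<m)
    ... | inj₁ (k , k<1+i , qₖ)        = ⊥-elim (<-irrefl (Q-unique qₖ q) (<-trans k<1+i (s<s i<m)))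
    ... | inj₂ (inj₁ (c , c<n , qc))  = c , <-≤-trans c<n (m≤m+n n _) , inj₁ (c<n , qc)
    ... | inj₂ (inj₂ r)               = suc i + K , bound , inj₂ (proj₂ (R-band r) , refl)
      where
      open ≤-Reasoning
      bound : suc i + K < n + suc (K + K)
      bound = begin-strict
        suc i + K     ≤⟨ +-monoˡ-≤ K (proj₁ (R-band r)) ⟩
        n + K + K     ≡⟨ +-assoc n K K ⟩
        n + (K + K)   <⟨ +-monoʳ-< n (n<1+n (K + K)) ⟩
        n + suc (K + K) ∎

    witness-injective : ∀ {i j c} → Witness i c → Witness j c → i ≡ j
    witness-injective (inj₁ (_ , qᵢ)) (inj₁ (_ , qⱼ))   = suc-injective (Q-unique qᵢ qⱼ)
    witness-injective (inj₂ (_ , eᵢ)) (inj₂ (_ , eⱼ))   =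
      suc-injective (+-cancelʳ-≡ K _ _ (trans (sym eᵢ) eⱼ))
    witness-injective (inj₁ (c<n , _)) (inj₂ (n≤c , _)) = ⊥-elim (<⇒≱ c<n n≤c)
    witness-injective (inj₂ (n≤c , _)) (inj₁ (c<n , _)) = ⊥-elim (<⇒≱ c<n n≤c)

    m≤ : m ≤ n + suc (K + K)
    m≤ = injection⇒≤ (λ i i<m → proj₁ (witness i i<m))
                     (λ i i<m → proj₁ (proj₂ (witness i i<m)))
           (λ i<m j<m eq → witness-injective (proj₂ (proj₂ (witness _ i<m)))
                             (subst (Witness _) (sym eq) (proj₂ (proj₂ (witness _ j<m)))))

FirstInRow-transfer : ∀ {Q : ℕ → ℕ → Set} {K} → (∀ {m n} → Q m n → n ≤ m + K) →
  ∀ {b b′ i j} → K ≤ j →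
  (∀ {i′} → i′ < i → Q (b′ + i′) (b′ + j) → Q (b + i′) (b + j)) →
  FirstInRow Q (b + i) (b + j) → FirstInRow Q (b′ + i) (b′ + j)
FirstInRow-transfer {Q} {K} band {b} {b′} {i} {j} K≤j back first {k} k<b′+i qₖ =
  first (+-monoʳ-< b i′<i) (back i′<i (subst (λ x → Q x (b′ + j)) (sym b′+i′≡k) qₖ))
  where
  b′+i′≡k : b′ + (k ∸ b′) ≡ k
  b′+i′≡k = m+[n∸m]≡n (+-cancelʳ-≤ K b′ k (≤-trans (+-monoʳ-≤ b′ K≤j) (band qₖ)))
  i′<i : k ∸ b′ < i
  i′<i = +-cancelˡ-< b′ _ i (subst (_< b′ + i) (sym b′+i′≡k) k<b′+i)

module DiagonalPeriodicity
  (P R : ℕ → ℕ → Set) (P? : ∀ m n → Dec (P m n)) (K N₀ π : ℕ) (1≤π : 1 ≤ π)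
  (band : ∀ {m n} → P m n → m ≤ n + K × n ≤ m + K)
  (recurrence : ∀ {m n} → N₀ < m → N₀ < n →
                P m n ⇔ (FirstInRow P m n × FirstInColumn P m n × R m n))
  (R-periodic : PeriodicBeyond R N₀ π)
  where

  P-≡ : ∀ {m m′ n n′} → m ≡ m′ → n ≡ n′ → P m n ⇔ P m′ n′
  P-≡ refl refl = ⇔-refl

  band-shift : ∀ b {i j} → P (b + i) (b + j) → i ≤ j + K × j ≤ i + K
  band-shift b {i} {j} p with band p
  ... | i≤ , j≤ = +-cancelˡ-≤ b i (j + K) (≤-trans i≤ (≤-reflexive (+-assoc b j K))) ,
                  +-cancelˡ-≤ b j (i + K) (≤-trans j≤ (≤-reflexive (+-assoc b i K)))

  P-transfer : ∀ {b b′ i j} → N₀ < b → N₀ < b′ → K ≤ i → K ≤ j →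
    (∀ {i′} → i′ < i → P (b′ + i′) (b′ + j) → P (b + i′) (b + j)) →
    (∀ {j′} → j′ < j → P (b′ + i) (b′ + j′) → P (b + i) (b + j′)) →
    (R (b + i) (b + j) → R (b′ + i) (b′ + j)) →
    P (b + i) (b + j) → P (b′ + i) (b′ + j)
  P-transfer {b} {b′} {i} {j} N₀<b N₀<b′ K≤i K≤j back-row back-column R-transfer p
    with to (recurrence (<-≤-trans N₀<b (m≤m+n b i)) (<-≤-trans N₀<b (m≤m+n b j))) p
  ... | first-row , first-column , r =
    from (recurrence (<-≤-trans N₀<b′ (m≤m+n b′ i)) (<-≤-trans N₀<b′ (m≤m+n b′ j)))
      ( FirstInRow-transfer (proj₂ ∘ band) K≤j back-row first-row
      , FirstInRow-transfer (proj₁ ∘ band) K≤i back-column first-column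
      , R-transfer r )

  Agree : ℕ → ℕ → ℕ → ℕ → Set
  Agree a p i j = P (a + i) (a + j) ⇔ P (a + p + i) (a + p + j)

  -- Outside the window [0, 2K)², a P-position (a + i, a + j) has i, j ≥ K, so all
  -- positions the recurrence looks at stay above the base a.
  module Propagation {a p} (N₀<a : N₀ < a) (R-p : PeriodicBeyond R N₀ p)
           (window : ∀ {i j} → i < K + K → j < K + K → Agree a p i j) where

    N₀<a+p : N₀ < a + p
    N₀<a+p = <-≤-trans N₀<a (m≤m+n a p)

    off-band : ∀ {i j} → ¬ (i ≤ j + K × j ≤ i + K) → Agree a p i j
    off-band off = mk⇔ (⊥-elim ∘ off ∘ band-shift a) (⊥-elim ∘ off ∘ band-shift (a + p))

    near-band : ∀ {i j} → K ≤ i → K ≤ j → (∀ {i′} → i′ < i → Agree a p i′ j) →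
                (∀ {j′} → j′ < j → Agree a p i j′) → Agree a p i j
    near-band {i} {j} K≤i K≤j row column =
      mk⇔ (P-transfer N₀<a N₀<a+p K≤i K≤j (from ∘ row) (from ∘ column) (to R-shift))
          (P-transfer N₀<a+p N₀<a K≤i K≤j (to ∘ row) (to ∘ column) (from R-shift))
      where
      R-shift : R (a + i) (a + j) ⇔ R (a + p + i) (a + p + j)
      R-shift = subst₂ (λ x y → R (a + i) (a + j) ⇔ R x y) (xy∙z≈xz∙y a i p) (xy∙z≈xz∙y a j p)
                  (R-p (a + i) (a + j) (<-≤-trans N₀<a (m≤m+n a i))
                                       (<-≤-trans N₀<a (m≤m+n a j)))

    far : ∀ {x y} → K + K ≤ x → x ≤ y + K → K ≤ x × K ≤ y
    far 2K≤x x≤y+K = ≤-trans (m≤m+n K K) 2K≤x , +-cancelʳ-≤ K K _ (≤-trans 2K≤x x≤y+K)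

    agree-step : ∀ {i j} → (∀ {i′} → i′ < i → Agree a p i′ j) →
                 (∀ {j′} → j′ < j → Agree a p i j′) → Agree a p i j
    agree-step {i} {j} row column with (i ≤? j + K) ×-dec (j ≤? i + K)
    ... | no off = off-band off
    ... | yes (i≤j+K , j≤i+K) with i <? K + K | j <? K + K
    ...   | yes i<2K | yes j<2K = window i<2K j<2K
    ...   | no i≮2K  | _        = let K≤i , K≤j = far (≮⇒≥ i≮2K) i≤j+K
                                  in near-band K≤i K≤j row column
    ...   | yes _    | no j≮2K  = let K≤j , K≤i = far (≮⇒≥ j≮2K) j≤i+K
                                  in near-band K≤i K≤j row column

    agree : ∀ i j → Acc _<_ (i + j) → Agree a p i j
    agree i j (acc rec) = agree-step (λ i′<i → agree _ j (rec (+-monoˡ-< j i′<i)))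
                                     (λ j′<j → agree i _ (rec (+-monoʳ-< i j′<j)))

    periodic : PeriodicBeyond P a p
    periodic m n a<m a<n =
      ⇔-trans (P-≡ (sym (a+m∸a m a<m)) (sym (a+m∸a n a<n)))
        (⇔-trans (agree (m ∸ a) (n ∸ a) (<-wellFounded _))
          (P-≡ (shifted m a<m) (shifted n a<n)))
      where
      a+m∸a : ∀ x → a < x → a + (x ∸ a) ≡ x
      a+m∸a x a<x = m+[n∸m]≡n (<⇒≤ a<x)
      shifted : ∀ x → a < x → a + p + (x ∸ a) ≡ x + p
      shifted x a<x = trans (sym (xy∙z≈xz∙y a (x ∸ a) p)) (cong (_+ p) (a+m∸a x a<x))

  -- Bases are spaced by π, so any two of them differ by a period of R.
  base : ℕ → ℕ
  base t = suc N₀ + t * π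

  window-code : ℕ → Fin (K + K) → Fin (2 ^ (K + K))
  window-code t i = encode (K + K) (λ j → bit (P? (base t + toℕ i) (base t + toℕ j)))

  window-agree : ∀ {t t′} → window-code t ≗ window-code t′ →
                 ∀ {i j} → i < K + K → j < K + K →
                 P (base t + i) (base t + j) ⇔ P (base t′ + i) (base t′ + j)
  window-agree eq {i} {j} i<2K j<2K
    with bit-≡⇒⇔ _ _ (encode-injective (K + K) (eq (fromℕ< i<2K)) (fromℕ< j<2K))
  ... | agreement rewrite toℕ-fromℕ< i<2K | toℕ-fromℕ< j<2K = agreement

  base-+ : ∀ t d → base (suc t + d) ≡ base t + suc d * π
  base-+ t d = identity N₀ t d π
    where
    identity : ∀ c t d π → suc c + (suc t + d) * π ≡ suc c + t * π + suc d * π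
    identity = solve-∀

  eventually-periodic : EventuallyPeriodic P
  eventually-periodic with repetition window-code
  ... | t , t′ , t<t′ , eq with m≤n⇒∃[o]m+o≡n t<t′
  ... | d , refl = base t , suc d * π , ≤-trans 1≤π (m≤n*m π (suc d)) ,
    Propagation.periodic (s≤s (m≤m+n N₀ (t * π)))
      (PeriodicBeyond-∣ {q = suc d * π} R-periodic (divides (suc d) refl))
      (λ {i} {j} i<2K j<2K → subst (λ b → P (base t + i) (base t + j) ⇔ P (b + i) (b + j))
                       (base-+ t d) (window-agree {t} {suc t + d} eq i<2K j<2K))

-- Tree nim

module TreeNim (T : Tree) where

  _[_≔_] : Position T → Vertex T → ℕ → Position T
  s [ v ≔ k ] = updateAt s v (const k)

  SameSupport : Position T → Position T → Set
  SameSupport s t = ∀ u → (0 <ᵇ s u) ≡ (0 <ᵇ t u)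

  ≗⇒SameSupport : ∀ {s t} → s ≗ t → SameSupport s t
  ≗⇒SameSupport s≗t u = cong (0 <ᵇ_) (s≗t u)

  deg-cong : ∀ {s t} v → SameSupport s t → deg T s v ≡ deg T t v
  deg-cong v same =
    cong sum (map-cong (λ u → cong (λ b → if adj T u v ∧ b then 1 else 0) (same u)) (allFin _))

  deg-≤-deg-T : ∀ s v → deg T s v ≤ deg T (const 1) v
  deg-≤-deg-T s v = sum-map-mono (λ u → indicator-≤ (adj T u v) (0 <ᵇ s u)) (allFin _)
    where
    indicator-≤ : ∀ b c → (if b ∧ c then 1 else 0) ≤ (if b ∧ true then 1 else 0)
    indicator-≤ false _     = z≤n
    indicator-≤ true  false = z≤n
    indicator-≤ true  true  = ≤-refl

  IsLeafT⇒IsLeaf : ∀ s {v} → IsLeafT T v → 0 < s v → IsLeaf T s v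
  IsLeafT⇒IsLeaf s {v} leafT alive = alive , ≤-trans (deg-≤-deg-T s v) leafT

  positive-<ᵇ : ∀ {x y} → 0 < x → 0 < y → (0 <ᵇ x) ≡ (0 <ᵇ y)
  positive-<ᵇ {suc _} {suc _} _ _ = refl

  IsLeaf-transfer : ∀ {s t v} → SameSupport s t → s v ≡ t v → IsLeaf T s v → IsLeaf T t v
  IsLeaf-transfer {s} {t} {v} same eq (alive , deg≤1) =
    subst (0 <_) eq alive , subst (_≤ 1) (deg-cong {s} {t} v same) deg≤1

  IsLeaf? : ∀ s v → Dec (IsLeaf T s v)
  IsLeaf? s v = (0 <? s v) ×-dec (deg T s v ≤? 1)

  update-move : ∀ {s v k} → IsLeaf T s v → k < s v → Move T s (s [ v ≔ k ])
  update-move {s} {v} leaf k<sv =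
    v , leaf , subst (_< s v) (sym (updateAt-updates v s)) k<sv ,
    λ u u≢v → updateAt-minimal u v s u≢v

  move-≗-update : ∀ {s s′} (mv : Move T s s′) → s′ ≗ s [ proj₁ mv ≔ s′ (proj₁ mv) ]
  move-≗-update {s} (v , _ , _ , others) u with u ≟ᶠ v
  ... | yes refl = sym (updateAt-updates v s)
  ... | no u≢v   = trans (others u u≢v) (sym (updateAt-minimal u v s u≢v))

  move-resp : ∀ {s t s′} → s ≗ t → Move T s s′ → Move T t s′
  move-resp {s} {t} s≗t (v , leaf , lt , others) =
    v , IsLeaf-transfer {s} {t} (≗⇒SameSupport s≗t) (s≗t v) leaf , subst (_ <_) (s≗t v) lt ,
    λ u u≢v → trans (others u u≢v) (s≗t u)

  move-decreases : ∀ {s s′} → Move T s s′ → total s′ < total s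
  move-decreases {s} mv@(v , _ , lt , _) =
    subst (_< total s) (sym (total-cong (move-≗-update mv))) (total-updateAt-< s v lt)

  IsP-resp : ∀ {s t} → s ≗ t → IsP T s → IsP T t
  IsP-resp s≗t (allToN toN) = allToN λ s′ mv → toN s′ (move-resp (sym ∘ s≗t) mv)

  IsP-cong : ∀ {s t} → s ≗ t → IsP T s ⇔ IsP T t
  IsP-cong s≗t = mk⇔ (IsP-resp s≗t) (IsP-resp (sym ∘ s≗t))

  IsP-IsN-exclusive : ∀ {s} → IsP T s → IsN T s → ⊥
  IsP-IsN-exclusive (allToN toN) (toP s′ mv p) = IsP-IsN-exclusive p (toN s′ mv)

  decide : ∀ {s} → IsP T s ⊎ IsN T s → Dec (IsP T s)
  decide (inj₁ p) = yes p
  decide (inj₂ n) = no λ p → IsP-IsN-exclusive p n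

  IsP⊎IsN : ∀ s → IsP T s ⊎ IsN T s
  IsP⊎IsN s = go s (<-wellFounded (total s))
    where
    go : ∀ s → Acc _<_ (total s) → IsP T s ⊎ IsN T s
    go s (acc rec) with any? (λ v → IsLeaf? s v ×-dec any? (λ (k : Fin (s v)) →
                          decide (go (s [ v ≔ toℕ k ]) (rec (total-updateAt-< s v (toℕ<n k))))))
    ... | yes (v , leaf , k , p) = inj₂ (toP _ (update-move leaf (toℕ<n k)) p)
    ... | no none = inj₁ (allToN λ s′ mv →
                            [ ⊥-elim ∘ none ∘ P-option mv , id ]′ (go s′ (rec (move-decreases mv))))
      where
      P-option : ∀ {s′} (mv : Move T s s′) → IsP T s′ →
                 ∃ λ v → IsLeaf T s v × ∃ λ (k : Fin (s v)) → IsP T (s [ v ≔ toℕ k ])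
      P-option mv@(v , leaf , lt , _) p = v , leaf , fromℕ< lt , IsP-resp s′≗ p
        where
        s′≗ : _ ≗ s [ v ≔ toℕ (fromℕ< lt) ]
        s′≗ u = trans (move-≗-update mv u) (cong (λ k → (s [ v ≔ k ]) u) (sym (toℕ-fromℕ< lt)))

  IsP? : ∀ s → Dec (IsP T s)
  IsP? s = decide (IsP⊎IsN s)

  ¬IsP⇒IsN : ∀ {s} → ¬ IsP T s → IsN T s
  ¬IsP⇒IsN {s} ¬p = [ ⊥-elim ∘ ¬p , id ]′ (IsP⊎IsN s)

  IsP⇒¬IsP-option : ∀ {s} v {k} → IsP T s → IsLeaf T s v → k < s v → ¬ IsP T (s [ v ≔ k ])
  IsP⇒¬IsP-option v (allToN toN) leaf lt p = IsP-IsN-exclusive p (toN _ (update-move leaf lt))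

  ¬IsP-options⇒IsP : ∀ {s} → (∀ v {k} → IsLeaf T s v → k < s v → ¬ IsP T (s [ v ≔ k ])) →
                     IsP T s
  ¬IsP-options⇒IsP none = allToN λ where
    s′ mv@(v , leaf , lt , _) → ¬IsP⇒IsN λ p → none v leaf lt (IsP-resp (move-≗-update mv) p)

  ¬IsP⇒IsP-option : ∀ {s} → ¬ IsP T s →
                    ∃₂ λ v k → IsLeaf T s v × k < s v × IsP T (s [ v ≔ k ])
  ¬IsP⇒IsP-option ¬p with ¬IsP⇒IsN ¬p
  ... | toP s′ mv@(v , leaf , lt , _) p = v , s′ v , leaf , lt , IsP-resp (move-≗-update mv) p

  module TwoLeaves (l₁ l₂ : Vertex T) (l₁-leaf : IsLeafT T l₁) (l₂-leaf : IsLeafT T l₂)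
                   (l₁≢l₂ : l₁ ≢ l₂) where

    withLeaves : Position T → ℕ → ℕ → Position T
    withLeaves s m n = s [ l₁ ≔ m ] [ l₂ ≔ n ]

    IsP₂ : Position T → ℕ → ℕ → Set
    IsP₂ s m n = IsP T (withLeaves s m n)

    Inner : Vertex T → Set
    Inner v = v ≢ l₁ × v ≢ l₂

    inner? : ∀ v → Dec (Inner v)
    inner? v = ¬? (v ≟ᶠ l₁) ×-dec ¬? (v ≟ᶠ l₂)

    vertex-cases : ∀ u → u ≡ l₁ ⊎ u ≡ l₂ ⊎ Inner u
    vertex-cases u with u ≟ᶠ l₁ | u ≟ᶠ l₂
    ... | yes u≡l₁ | _        = inj₁ u≡l₁
    ... | no _     | yes u≡l₂ = inj₂ (inj₁ u≡l₂)
    ... | no u≢l₁  | no u≢l₂  = inj₂ (inj₂ (u≢l₁ , u≢l₂))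

    withLeaves-l₁ : ∀ s m n → withLeaves s m n l₁ ≡ m
    withLeaves-l₁ s m n = trans (updateAt-minimal l₁ l₂ _ l₁≢l₂) (updateAt-updates l₁ s)

    withLeaves-l₂ : ∀ s m n → withLeaves s m n l₂ ≡ n
    withLeaves-l₂ s m n = updateAt-updates l₂ _

    withLeaves-inner : ∀ s m n {u} → Inner u → withLeaves s m n u ≡ s u
    withLeaves-inner s m n (u≢l₁ , u≢l₂) =
      trans (updateAt-minimal _ l₂ _ u≢l₂) (updateAt-minimal _ l₁ s u≢l₁)

    ≗withLeaves : ∀ {t s m n} → t l₁ ≡ m → t l₂ ≡ n → (∀ {u} → Inner u → t u ≡ s u) →
                  t ≗ withLeaves s m n
    ≗withLeaves {s = s} {m} {n} at-l₁ at-l₂ at-inner u with vertex-cases u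
    ... | inj₁ refl         = trans at-l₁ (sym (withLeaves-l₁ s m n))
    ... | inj₂ (inj₁ refl)  = trans at-l₂ (sym (withLeaves-l₂ s m n))
    ... | inj₂ (inj₂ inner) = trans (at-inner inner) (sym (withLeaves-inner s m n inner))

    update-l₁ : ∀ s m n k → withLeaves s m n [ l₁ ≔ k ] ≗ withLeaves s k n
    update-l₁ s m n k = ≗withLeaves (updateAt-updates l₁ _)
      (trans (updateAt-minimal l₂ l₁ _ (l₁≢l₂ ∘ sym)) (withLeaves-l₂ s m n))
      (λ inner → trans (updateAt-minimal _ l₁ _ (proj₁ inner)) (withLeaves-inner s m n inner))

    update-l₂ : ∀ s m n k → withLeaves s m n [ l₂ ≔ k ] ≗ withLeaves s m k
    update-l₂ s m n k = ≗withLeaves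
      (trans (updateAt-minimal l₁ l₂ _ l₁≢l₂) (withLeaves-l₁ s m n)) (updateAt-updates l₂ _)
      (λ inner → trans (updateAt-minimal _ l₂ _ (proj₂ inner)) (withLeaves-inner s m n inner))

    update-inner : ∀ s m n {v} k → Inner v →
                   withLeaves s m n [ v ≔ k ] ≗ withLeaves (s [ v ≔ k ]) m n
    update-inner s m n {v} k (v≢l₁ , v≢l₂) = ≗withLeaves
      (trans (updateAt-minimal l₁ v _ (v≢l₁ ∘ sym)) (withLeaves-l₁ s m n))
      (trans (updateAt-minimal l₂ v _ (v≢l₂ ∘ sym)) (withLeaves-l₂ s m n))
      at-inner
      where
      at-inner : ∀ {u} → Inner u → (withLeaves s m n [ v ≔ k ]) u ≡ (s [ v ≔ k ]) u
      at-inner {u} inner with u ≟ᶠ v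
      ... | yes refl = trans (updateAt-updates v _) (sym (updateAt-updates v s))
      ... | no u≢v   = trans (updateAt-minimal u v _ u≢v)
                         (trans (withLeaves-inner s m n inner) (sym (updateAt-minimal u v s u≢v)))

    alive-l₁ : ∀ s {m} n → 0 < m → 0 < withLeaves s m n l₁
    alive-l₁ s n 0<m = subst (0 <_) (sym (withLeaves-l₁ s _ n)) 0<m

    alive-l₂ : ∀ s m {n} → 0 < n → 0 < withLeaves s m n l₂
    alive-l₂ s m 0<n = subst (0 <_) (sym (withLeaves-l₂ s m _)) 0<n

    withLeaves-support : ∀ s {m n m′ n′} → 0 < m → 0 < n → 0 < m′ → 0 < n′ →
                         SameSupport (withLeaves s m n) (withLeaves s m′ n′)
    withLeaves-support s {m} {n} {m′} {n′} 0<m 0<n 0<m′ 0<n′ u with vertex-cases u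
    ... | inj₁ refl         = positive-<ᵇ (alive-l₁ s n 0<m) (alive-l₁ s n′ 0<m′)
    ... | inj₂ (inj₁ refl)  = positive-<ᵇ (alive-l₂ s m 0<n) (alive-l₂ s m′ 0<n′)
    ... | inj₂ (inj₂ inner) =
      cong (0 <ᵇ_) (trans (withLeaves-inner s m n inner) (sym (withLeaves-inner s m′ n′ inner)))

    inner-leaf-transfer : ∀ s {m n m′ n′ v} → 0 < m → 0 < n → 0 < m′ → 0 < n′ → Inner v →
                          IsLeaf T (withLeaves s m n) v → IsLeaf T (withLeaves s m′ n′) v
    inner-leaf-transfer s {m} {n} {m′} {n′} 0<m 0<n 0<m′ 0<n′ inner =
      IsLeaf-transfer {withLeaves s m n} {withLeaves s m′ n′}
        (withLeaves-support s 0<m 0<n 0<m′ 0<n′)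
        (trans (withLeaves-inner s m n inner) (sym (withLeaves-inner s m′ n′ inner)))

    row-move : ∀ {s m n k} → IsP₂ s m n → k < m → ¬ IsP₂ s k n
    row-move {s} {m} {n} {k} p k<m pₖ =
      IsP⇒¬IsP-option l₁ p
        (IsLeafT⇒IsLeaf (withLeaves s m n) l₁-leaf (alive-l₁ s n (≤-<-trans z≤n k<m)))
        (subst (k <_) (sym (withLeaves-l₁ s m n)) k<m) (IsP-resp (sym ∘ update-l₁ s m n k) pₖ)

    column-move : ∀ {s m n k} → IsP₂ s m n → k < n → ¬ IsP₂ s m k
    column-move {s} {m} {n} {k} p k<n pₖ =
      IsP⇒¬IsP-option l₂ p
        (IsLeafT⇒IsLeaf (withLeaves s m n) l₂-leaf (alive-l₂ s m (≤-<-trans z≤n k<n)))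
        (subst (k <_) (sym (withLeaves-l₂ s m n)) k<n) (IsP-resp (sym ∘ update-l₂ s m n k) pₖ)

    inner-move : ∀ {s m n v k} → IsP₂ s m n → Inner v → IsLeaf T (withLeaves s m n) v → k < s v →
                 ¬ IsP₂ (s [ v ≔ k ]) m n
    inner-move {s} {m} {n} {v} {k} p inner leaf k<sv pₖ =
      IsP⇒¬IsP-option v p leaf (subst (k <_) (sym (withLeaves-inner s m n inner)) k<sv)
        (IsP-resp (sym ∘ update-inner s m n k inner) pₖ)

    row-unique : ∀ {s m m′ n} → IsP₂ s m n → IsP₂ s m′ n → m ≡ m′
    row-unique {s} {n = n} = at-most-one {λ x → IsP₂ s x n} λ x<y p → row-move p x<y

    column-unique : ∀ {s m n n′} → IsP₂ s m n → IsP₂ s m n′ → n ≡ n′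
    column-unique {s} {m} = at-most-one {λ x → IsP₂ s m x} λ x<y p → column-move p x<y

    classify-option : ∀ {s m n} v {k} → k < withLeaves s m n v → IsP T (withLeaves s m n [ v ≔ k ]) →
      (k < m × IsP₂ s k n) ⊎ (k < n × IsP₂ s m k) ⊎ (Inner v × k < s v × IsP₂ (s [ v ≔ k ]) m n)
    classify-option {s} {m} {n} v {k} k< p with vertex-cases v
    ... | inj₁ refl         =
      inj₁ (subst (k <_) (withLeaves-l₁ s m n) k< , IsP-resp (update-l₁ s m n k) p)
    ... | inj₂ (inj₁ refl)  =
      inj₂ (inj₁ (subst (k <_) (withLeaves-l₂ s m n) k< , IsP-resp (update-l₂ s m n k) p))
    ... | inj₂ (inj₂ inner) =
      inj₂ (inj₂ (inner , subst (k <_) (withLeaves-inner s m n inner) k< ,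
                  IsP-resp (update-inner s m n k inner) p))

    SomeInnerOptionP : Position T → ℕ → ℕ → Set
    SomeInnerOptionP s m n = ∃₂ λ v k → Inner v × k < s v × IsP₂ (s [ v ≔ k ]) m n

    -- Which inner vertices are leaves is the same for all m, n > 0; it is read off at (1, 1).
    NoInnerOptionP : Position T → ℕ → ℕ → Set
    NoInnerOptionP s m n =
      ∀ {v k} → Inner v → IsLeaf T (withLeaves s 1 1) v → k < s v → ¬ IsP₂ (s [ v ≔ k ]) m n

    ¬IsP₂⇒P-option : ∀ {s m n} → ¬ IsP₂ s m n →
      (∃ λ k → k < m × IsP₂ s k n) ⊎ (∃ λ k → k < n × IsP₂ s m k) ⊎ SomeInnerOptionP s m n
    ¬IsP₂⇒P-option ¬p with ¬IsP⇒IsP-option ¬p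
    ... | v , k , _ , k< , p with classify-option v k< p
    ...   | inj₁ row               = inj₁ (k , row)
    ...   | inj₂ (inj₁ column)     = inj₂ (inj₁ (k , column))
    ...   | inj₂ (inj₂ inner)      = inj₂ (inj₂ (v , k , inner))

    IsP₂-recurrence : ∀ {s m n} → 0 < m → 0 < n →
      IsP₂ s m n ⇔ (FirstInRow (IsP₂ s) m n × FirstInColumn (IsP₂ s) m n × NoInnerOptionP s m n)
    IsP₂-recurrence {s} {m} {n} 0<m 0<n = mk⇔ forward backward
      where
      forward : IsP₂ s m n →
                FirstInRow (IsP₂ s) m n × FirstInColumn (IsP₂ s) m n × NoInnerOptionP s m n
      forward p = row-move p , column-move p , λ inner leaf →
        inner-move p inner (inner-leaf-transfer s 0<1+n 0<1+n 0<m 0<n inner leaf)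

      backward : FirstInRow (IsP₂ s) m n × FirstInColumn (IsP₂ s) m n × NoInnerOptionP s m n →
                 IsP₂ s m n
      backward (first-row , first-column , none) = ¬IsP-options⇒IsP λ v leaf k< p →
        case classify-option v k< p of λ where
          (inj₁ (k<m , row))                    → first-row k<m row
          (inj₂ (inj₁ (k<n , column)))          → first-column k<n column
          (inj₂ (inj₂ (inner , k<sv , option))) →
            none inner (inner-leaf-transfer s 0<m 0<n 0<1+n 0<1+n inner leaf) k<sv option

    Band : Position T → ℕ → Set
    Band s K = ∀ {m n} → IsP₂ s m n → m ≤ n + K × n ≤ m + K

    Band-mono : ∀ {s} → UpwardClosed (Band s)
    Band-mono K≤K′ band p = let m≤ , n≤ = band p in
      ≤-trans m≤ (+-monoʳ-≤ _ K≤K′) , ≤-trans n≤ (+-monoʳ-≤ _ K≤K′)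

    -- A single c serves as band width, threshold and, through c !, period; this makes
    -- Regular s upward closed in c, so finitely many options share a common c.
    Regular : Position T → ℕ → Set
    Regular s c = Band s c × PeriodicBeyond (IsP₂ s) c (c !)

    Regular-mono : ∀ {s} → UpwardClosed (Regular s)
    Regular-mono c≤c′ (band , periodic) =
      Band-mono c≤c′ band ,
      PeriodicBeyond-mono c≤c′ (PeriodicBeyond-∣ periodic (m≤n⇒m!∣n! c≤c′))

    Band∧EventuallyPeriodic⇒Regular : ∀ {s K} → Band s K → EventuallyPeriodic (IsP₂ s) →
                                      ∃ (Regular s)
    Band∧EventuallyPeriodic⇒Regular {K = K} band (N , p , 1≤p , periodic) = K ⊔ N ⊔ p ,
      Band-mono (≤-trans (m≤m⊔n K N) (m≤m⊔n (K ⊔ N) p)) band ,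
      PeriodicBeyond-! periodic 1≤p (≤-trans (m≤n⊔m K N) (m≤m⊔n (K ⊔ N) p)) (m≤n⊔m (K ⊔ N) p)

    regular-step : ∀ {s c} → (∀ {v k} → Inner v → k < s v → Regular (s [ v ≔ k ]) c) →
                   ∃ (Regular s)
    regular-step {s} {c} options = Band∧EventuallyPeriodic⇒Regular band eventually-periodic
      where
      K : ℕ
      K = 2 + c + c

      option-band : ∀ {m n} → SomeInnerOptionP s m n → m ≤ n + c × n ≤ m + c
      option-band (_ , _ , inner , k<sv , p) = proj₁ (options inner k<sv) p

      swap-row-column : ∀ {A B C : Set} → A ⊎ B ⊎ C → B ⊎ A ⊎ C
      swap-row-column = [ inj₂ ∘ inj₁ , [ inj₁ , inj₂ ∘ inj₂ ]′ ]′

      band : Band s K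
      band p = row-bound (IsP₂ s) (SomeInnerOptionP s) c row-unique option-band ¬IsP₂⇒P-option p ,
               row-bound (flip (IsP₂ s)) (flip (SomeInnerOptionP s)) c column-unique
                 (swap ∘ option-band) (swap-row-column ∘ ¬IsP₂⇒P-option) p

      options-periodic : PeriodicBeyond (NoInnerOptionP s) c (c !)
      options-periodic m n c<m c<n = mk⇔
        (λ none {v} {k} inner leaf k<sv → none inner leaf k<sv ∘ from (shift inner k<sv))
        (λ none {v} {k} inner leaf k<sv → none inner leaf k<sv ∘ to (shift inner k<sv))
        where
        shift : ∀ {v k} → Inner v → k < s v →
                IsP₂ (s [ v ≔ k ]) m n ⇔ IsP₂ (s [ v ≔ k ]) (m + c !) (n + c !)
        shift inner k<sv = proj₂ (options inner k<sv) m n c<m c<n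

      open DiagonalPeriodicity (IsP₂ s) (NoInnerOptionP s) (λ m n → IsP? (withLeaves s m n))
             K c (c !) (1≤n! c) band
             (λ c<m c<n → IsP₂-recurrence (≤-<-trans z≤n c<m) (≤-<-trans z≤n c<n)) options-periodic

    measure : Position T → ℕ
    measure s = total (withLeaves s 0 0)

    measure-< : ∀ {s v k} → Inner v → k < s v → measure (s [ v ≔ k ]) < measure s
    measure-< {s} {v} {k} inner k<sv =
      subst (_< measure s) (total-cong (update-inner s 0 0 k inner))
        (total-updateAt-< (withLeaves s 0 0) v (subst (k <_) (sym (withLeaves-inner s 0 0 inner)) k<sv))

    regular : ∀ s → ∃ (Regular s)
    regular s = go s (<-wellFounded (measure s))
      where
      go : ∀ s → Acc _<_ (measure s) → ∃ (Regular s)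
      go s (acc rec) = regular-step (λ {v} {k} inner k<sv → proj₂ common v k k<sv inner)
        where
        option : ∀ v k → k < s v → ∃ λ c → Inner v → Regular (s [ v ≔ k ]) c
        option v k k<sv = ∃-under-Dec (inner? v) λ inner → go _ (rec (measure-< inner k<sv))

        common : ∃ λ c → ∀ v k → k < s v → Inner v → Regular (s [ v ≔ k ]) c
        common = common-bound {P = λ v c → ∀ k → k < s v → Inner v → Regular (s [ v ≔ k ]) c}
                   (λ v c≤c′ all k k<sv → Regular-mono c≤c′ ∘ all k k<sv)
                   (λ v → common-bound< {P = λ k c → Inner v → Regular (s [ v ≔ k ]) c}
                            (λ k c≤c′ regular → Regular-mono c≤c′ ∘ regular) (s v) (option v))

    Regular⇒EventuallyPeriodic : ∀ {s} → ∃ (Regular s) → EventuallyPeriodic (IsP₂ s)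
    Regular⇒EventuallyPeriodic (c , _ , periodic) = c , c ! , 1≤n! c , periodic

    IsP₂-eventually-periodic : ∀ s → EventuallyPeriodic (IsP₂ s)
    IsP₂-eventually-periodic s = Regular⇒EventuallyPeriodic (regular s)

-- Worlds

findIndex-complete : ∀ {d k} (f : Fin d → Fin k) → (∀ i j → f i ≡ f j → i ≡ j) →
                     ∀ i → findIndex f (f i) ≡ just i
findIndex-complete f f-inj zero with f zero ≟ᶠ f zero
... | yes _  = refl
... | no ≢   = ⊥-elim (≢ refl)
findIndex-complete f f-inj (suc i) with f zero ≟ᶠ f (suc i)
... | yes eq = ⊥-elim (Fin.0≢1+n (f-inj _ _ eq))
... | no _ rewrite findIndex-complete (f ∘ suc) (λ i j eq → Fin.suc-injective (f-inj _ _ eq)) i = refl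

findIndex-sound : ∀ {d k} (f : Fin d → Fin k) {v i} → findIndex f v ≡ just i → f i ≡ v
findIndex-sound {suc d} f {v} eq with f zero ≟ᶠ v
findIndex-sound {suc d} f {v} refl | yes f₀≡v = f₀≡v
... | no _ with findIndex (f ∘ suc) v in eq′
findIndex-sound {suc d} f {v} refl | no _ | just j = findIndex-sound (f ∘ suc) eq′

lW⁻¹-leaf : ∀ {d} (W : World d) t i → lW⁻¹ W t (World.leaf W i) ≡ t i
lW⁻¹-leaf W t i rewrite findIndex-complete (World.leaf W) (World.leaf-inj W) i = refl

lW⁻¹-tuple-off-leaves : ∀ {e} (W : World (2 + e)) (a : Fin e → ℕ) {m n m′ n′ u} →
  u ≢ World.leaf W zero → u ≢ World.leaf W (suc zero) →
  lW⁻¹ W (tuple m n a) u ≡ lW⁻¹ W (tuple m′ n′ a) u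
lW⁻¹-tuple-off-leaves W a {u = u} u≢l₁ u≢l₂ with findIndex (World.leaf W) u in eq
... | just zero          = ⊥-elim (u≢l₁ (sym (findIndex-sound (World.leaf W) eq)))
... | just (suc zero)    = ⊥-elim (u≢l₂ (sym (findIndex-sound (World.leaf W) eq)))
... | just (suc (suc _)) = refl
... | nothing            = refl

module BirayOfWorld {e} (W : World (2 + e)) (a : Fin e → ℕ) where
  open World W
  open TreeNim tree
  open TwoLeaves (leaf zero) (leaf (suc zero)) (leaf-leaf zero) (leaf-leaf (suc zero))
                 (Fin.0≢1+n ∘ leaf-inj _ _)

  s₀ : Position tree
  s₀ = lW⁻¹ W (tuple 0 0 a)

  lW⁻¹≗withLeaves : ∀ m n → lW⁻¹ W (tuple m n a) ≗ withLeaves s₀ m n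
  lW⁻¹≗withLeaves m n =
    ≗withLeaves (lW⁻¹-leaf W (tuple m n a) zero) (lW⁻¹-leaf W (tuple m n a) (suc zero))
      (λ inner → lW⁻¹-tuple-off-leaves W a (proj₁ inner) (proj₂ inner))

  biray-eventually-periodic : EventuallyPeriodic (λ m n → IsP tree (lW⁻¹ W (tuple m n a)))
  biray-eventually-periodic =
    EventuallyPeriodic-cong (λ m n → ⇔-sym (IsP-cong (lW⁻¹≗withLeaves m n))) (IsP₂-eventually-periodic s₀)

mainTheorem7 : (e : ℕ) (W : World (2 + e)) (a : Fin e → ℕ) → (∀ i → 0 < a i) →
    Σ ℕ λ N → Σ ℕ λ π → 1 ≤ π ×
      (∀ m n → N < m → N < n →
        (IsP (World.tree W) (lW⁻¹ W (tuple m n a))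
          ⇔ IsP (World.tree W) (lW⁻¹ W (tuple (m + π) (n + π) a))))
mainTheorem7 e W a _ = BirayOfWorld.biray-eventually-periodic W a
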